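{- Let $S=(\mathcal{P},\mathcal{L})$ be a finite linear space and $G\leq\mathrm{Aut}(S)$ transitive on $\mathcal{L}$; let $\ell\in\mathcal{L}$. Let $T=(\mathcal{P}(\ell),\mathcal{TL})$ be a linear space with $G_\ell^\ell\leq\mathrm{Aut}(T)$. Let $R$ be the incidence structure with point set $\mathcal{P}$ and line set $\{t^g: t\in\mathcal{TL}, g\in G\}$. Then $R$ is a linear space, $R$ is a refinement of $S$, and $G\leq \mathrm{Aut}(R)$.
   Context: A linear space consists of points and lines (subsets of the point set) such that every pair of distinct points lies in exactly one line; automorphisms are permutations of the points preserving the set of lines. $\mathcal{P}(\ell)$ denotes the set of points incident with $\ell$. $G_\ell$ is the setwise stabiliser of $\mathcal{P}(\ell)$ in $G$, $G_{[\ell]}$ its pointwise stabiliser, and $G_\ell^\ell$ the permutation group induced by $G_\ell$ on $\mathcal{P}(\ell)$. A linear space $R=(\mathcal{P},\mathcal{L}')$ is a refinement of $S=(\mathcal{P},\mathcal{L})$ if every line of $R$ is contained in some line of $S$. -}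

module Defs where

open import Data.Nat using (ℕ)
open import Data.Fin using (Fin)
open import Data.Fin.Subset using (Subset; _∈_; _⊆_; ⊤)
open import Data.Fin.Permutation using (Permutation; _⟨$⟩ˡ_; id; flip; _∘ₚ_)
open import Data.Vec using (tabulate; lookup)
open import Data.Product using (Σ; _×_; ∃)
open import Relation.Binary.PropositionalEquality using (_≡_; _≢_)
open import Function.Bundles using (_⇔_)

LineSet : ℕ → Set₁
LineSet n = Subset n → Set

record IsLinearSpace {n : ℕ} (P : Subset n) (Lines : LineSet n) : Set where
  field
    lines⊆points : ∀ L → Lines L → L ⊆ P
    uniqueLine : ∀ x y → x ∈ P → y ∈ P → x ≢ y →
      Σ (Subset n) λ L → Lines L × x ∈ L × y ∈ L ×
        (∀ L′ → Lines L′ → x ∈ L′ → y ∈ L′ → L′ ≡ L)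

-- Image L^g of a subset under a permutation g : y ∈ L^g iff g⁻¹ y ∈ L.
_^_ : {n : ℕ} → Subset n → Permutation n n → Subset n
L ^ g = tabulate λ y → lookup L (g ⟨$⟩ˡ y)

IsAut : {n : ℕ} → LineSet n → Permutation n n → Set
IsAut Lines g = ∀ L → Lines L ⇔ Lines (L ^ g)

record IsPermGroup {n : ℕ} (G : Permutation n n → Set) : Set where
  field
    id∈ : G id
    ∘∈ : ∀ g h → G g → G h → G (g ∘ₚ h)
    inv∈ : ∀ g → G g → G (flip g)

LineTransitive : {n : ℕ} → (Permutation n n → Set) → LineSet n → Set
LineTransitive {n} G Lines = ∀ L L′ → Lines L → Lines L′ →
  Σ (Permutation n n) λ g → G g × (L ^ g) ≡ L′

-- G_ℓ^ℓ ≤ Aut(T) where T has point set P(ℓ): every g ∈ G stabilising ℓ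
-- induces on P(ℓ) a permutation preserving the lines of T.
StabInducesAut : {n : ℕ} → (Permutation n n → Set) → Subset n → LineSet n → Set
StabInducesAut {n} G ℓ TL = ∀ g → G g → (ℓ ^ g) ≡ ℓ →
  ∀ t → t ⊆ ℓ → TL t ⇔ TL (t ^ g)

OrbitLines : {n : ℕ} → (Permutation n n → Set) → LineSet n → LineSet n
OrbitLines {n} G TL L = Σ (Subset n) λ t → Σ (Permutation n n) λ g →
  TL t × G g × L ≡ (t ^ g)

IsRefinement : {n : ℕ} → LineSet n → LineSet n → Set
IsRefinement {n} LR LS = ∀ L → LR L → Σ (Subset n) λ M → LS M × L ⊆ M

{-# OPTIONS --safe #-}
-- Every line of R through two points x, y lies in the line M of S through
-- them: if t ^ h ∋ x, y then ℓ ^ h is a line of S through x, y, so ℓ ^ h = M.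
-- Fixing one g ∈ G with ℓ ^ g = M, the element h ∘ g⁻¹ stabilises ℓ and hence
-- maps lines of T to lines of T, so every line of R through x and y has the
-- form s ^ g with s a line of T through g⁻¹ x and g⁻¹ y.  This reduces
-- existence and uniqueness of the line of R through x, y to the corresponding
-- properties of T.
module Submission where

open import Defs
open import Data.Nat using (ℕ)
open import Data.Fin using (Fin)
open import Data.Fin.Subset using (Subset; ⊤; _∈_; _⊆_)
open import Data.Fin.Subset.Properties using (∈⊤)
open import Data.Fin.Permutation
  using (Permutation; _⟨$⟩ˡ_; _⟨$⟩ʳ_; flip; _∘ₚ_; inverseˡ; inverseʳ)
open import Data.Vec using (tabulate; lookup)
open import Data.Vec.Properties
  using (lookup∘tabulate; tabulate∘lookup; tabulate-cong; []=⇒lookup; lookup⇒[]=)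
open import Data.Product using (_×_; _,_; Σ)
open import Relation.Binary.PropositionalEquality
open import Function.Bundles using (Equivalence; mk⇔)

module _ {n : ℕ} where

  ⟨$⟩ˡ-injective : (g : Permutation n n) {x y : Fin n} →
    g ⟨$⟩ˡ x ≡ g ⟨$⟩ˡ y → x ≡ y
  ⟨$⟩ˡ-injective g {x} {y} eq = begin
    x                     ≡⟨ inverseʳ g ⟨
    g ⟨$⟩ʳ (g ⟨$⟩ˡ x)     ≡⟨ cong (g ⟨$⟩ʳ_) eq ⟩
    g ⟨$⟩ʳ (g ⟨$⟩ˡ y)     ≡⟨ inverseʳ g ⟩
    y                     ∎
    where open ≡-Reasoning

  ^-∘ₚ : (L : Subset n) (g h : Permutation n n) → (L ^ g) ^ h ≡ L ^ (g ∘ₚ h)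
  ^-∘ₚ L g h = tabulate-cong λ y → lookup∘tabulate _ (h ⟨$⟩ˡ y)

  ^-fixed : (L : Subset n) (g : Permutation n n) →
    (∀ y → g ⟨$⟩ˡ y ≡ y) → L ^ g ≡ L
  ^-fixed L g fixed =
    trans (tabulate-cong λ y → cong (lookup L) (fixed y)) (tabulate∘lookup L)

  ^-^-flip : (L : Subset n) (g : Permutation n n) → (L ^ g) ^ flip g ≡ L
  ^-^-flip L g = trans (^-∘ₚ L g (flip g)) (^-fixed L (g ∘ₚ flip g) λ _ → inverseˡ g)

  ^-flip-^ : (L : Subset n) (g : Permutation n n) → (L ^ flip g) ^ g ≡ L
  ^-flip-^ L g = trans (^-∘ₚ L (flip g) g) (^-fixed L (flip g ∘ₚ g) λ _ → inverseʳ g)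

  ∈-^⁻ : (L : Subset n) (g : Permutation n n) {x : Fin n} →
    x ∈ L ^ g → g ⟨$⟩ˡ x ∈ L
  ∈-^⁻ L g {x} x∈ = lookup⇒[]= _ L (trans (sym (lookup∘tabulate _ x)) ([]=⇒lookup x∈))

  ∈-^⁺ : (L : Subset n) (g : Permutation n n) {x : Fin n} →
    g ⟨$⟩ˡ x ∈ L → x ∈ L ^ g
  ∈-^⁺ L g {x} x∈ = lookup⇒[]= _ (L ^ g) (trans (lookup∘tabulate _ x) ([]=⇒lookup x∈))

  ⊆-^ : {A B : Subset n} (g : Permutation n n) → A ⊆ B → A ^ g ⊆ B ^ g
  ⊆-^ {A} {B} g A⊆B x∈ = ∈-^⁺ B g (A⊆B (∈-^⁻ A g x∈))

module _ {n : ℕ} {G : Permutation n n → Set} {TL : LineSet n} where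

  orbitLines-isAut : IsPermGroup G → ∀ g → G g → IsAut (OrbitLines G TL) g
  orbitLines-isAut G-grp g g∈G L = mk⇔ image preimage
    where
    open IsPermGroup G-grp

    image : OrbitLines G TL L → OrbitLines G TL (L ^ g)
    image (t , h , t∈TL , h∈G , L≡tʰ) =
      t , h ∘ₚ g , t∈TL , ∘∈ h g h∈G g∈G ,
      trans (cong (_^ g) L≡tʰ) (^-∘ₚ t h g)

    preimage : OrbitLines G TL (L ^ g) → OrbitLines G TL L
    preimage (t , h , t∈TL , h∈G , Lᵍ≡tʰ) =
      t , h ∘ₚ flip g , t∈TL , ∘∈ h (flip g) h∈G (inv∈ g g∈G) ,
      trans (sym (^-^-flip L g))
            (trans (cong (_^ flip g) Lᵍ≡tʰ) (^-∘ₚ t h (flip g)))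

  orbitLines-refines : {LS : LineSet n} {ℓ : Subset n} →
    (∀ g → G g → IsAut LS g) → LS ℓ → (∀ t → TL t → t ⊆ ℓ) →
    IsRefinement (OrbitLines G TL) LS
  orbitLines-refines {ℓ = ℓ} G-aut ℓ∈LS TL⊆ℓ L (t , g , t∈TL , g∈G , refl) =
    ℓ ^ g , Equivalence.to (G-aut g g∈G ℓ) ℓ∈LS , ⊆-^ g (TL⊆ℓ t t∈TL)

  orbitLine-translate : {ℓ : Subset n} → IsPermGroup G →
    StabInducesAut G ℓ TL → (∀ t → TL t → t ⊆ ℓ) →
    ∀ {g h t} → G g → G h → TL t → ℓ ^ h ≡ ℓ ^ g →
    Σ (Subset n) λ s → TL s × t ^ h ≡ s ^ g
  orbitLine-translate {ℓ} G-grp stab TL⊆ℓ {g} {h} {t} g∈G h∈G t∈TL ℓʰ≡ℓᵍ =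
    t ^ k , Equivalence.to (stab k k∈G ℓᵏ≡ℓ t (TL⊆ℓ t t∈TL)) t∈TL , tʰ≡tᵏᵍ
    where
    open IsPermGroup G-grp
    open ≡-Reasoning
    k : Permutation n n
    k = h ∘ₚ flip g

    k∈G : G k
    k∈G = ∘∈ h (flip g) h∈G (inv∈ g g∈G)

    ℓᵏ≡ℓ : ℓ ^ k ≡ ℓ
    ℓᵏ≡ℓ = begin
      ℓ ^ k                 ≡⟨ ^-∘ₚ ℓ h (flip g) ⟨
      (ℓ ^ h) ^ flip g      ≡⟨ cong (_^ flip g) ℓʰ≡ℓᵍ ⟩
      (ℓ ^ g) ^ flip g      ≡⟨ ^-^-flip ℓ g ⟩
      ℓ                     ∎

    tʰ≡tᵏᵍ : t ^ h ≡ (t ^ k) ^ g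
    tʰ≡tᵏᵍ = begin
      t ^ h                   ≡⟨ ^-flip-^ (t ^ h) g ⟨
      ((t ^ h) ^ flip g) ^ g  ≡⟨ cong (_^ g) (^-∘ₚ t h (flip g)) ⟩
      (t ^ k) ^ g             ∎

  orbitLines-isLinearSpace : {LS : LineSet n} {ℓ : Subset n} →
    IsLinearSpace ⊤ LS → IsPermGroup G → (∀ g → G g → IsAut LS g) →
    LineTransitive G LS → LS ℓ → IsLinearSpace ℓ TL → StabInducesAut G ℓ TL →
    IsLinearSpace ⊤ (OrbitLines G TL)
  orbitLines-isLinearSpace {LS} {ℓ} S-lin G-grp G-aut G-tr ℓ∈LS T-lin stab =
    record { lines⊆points = λ _ _ _ → ∈⊤ ; uniqueLine = uniqueLine }
    where
    module S = IsLinearSpace S-lin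
    module T = IsLinearSpace T-lin

    uniqueLine : ∀ x y → x ∈ ⊤ → y ∈ ⊤ → x ≢ y →
      Σ (Subset n) λ L → OrbitLines G TL L × x ∈ L × y ∈ L ×
        (∀ L′ → OrbitLines G TL L′ → x ∈ L′ → y ∈ L′ → L′ ≡ L)
    uniqueLine x y _ _ x≢y
      with S.uniqueLine x y ∈⊤ ∈⊤ x≢y
    ... | M , M∈LS , x∈M , y∈M , M-unique
      with G-tr ℓ M ℓ∈LS M∈LS
    ... | g , g∈G , refl
      with T.uniqueLine (g ⟨$⟩ˡ x) (g ⟨$⟩ˡ y) (∈-^⁻ ℓ g x∈M) (∈-^⁻ ℓ g y∈M)
             (λ eq → x≢y (⟨$⟩ˡ-injective g eq))
    ... | t , t∈TL , x′∈t , y′∈t , t-unique =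
      t ^ g , (t , g , t∈TL , g∈G , refl) , ∈-^⁺ t g x′∈t , ∈-^⁺ t g y′∈t ,
      unique
      where
      unique : ∀ L′ → OrbitLines G TL L′ → x ∈ L′ → y ∈ L′ → L′ ≡ t ^ g
      unique _ (t′ , h , t′∈TL , h∈G , refl) x∈t′ʰ y∈t′ʰ
        with orbitLine-translate G-grp stab T.lines⊆points g∈G h∈G t′∈TL
               (M-unique (ℓ ^ h) (Equivalence.to (G-aut h h∈G ℓ) ℓ∈LS)
                 (⊆-^ h (T.lines⊆points t′ t′∈TL) x∈t′ʰ)
                 (⊆-^ h (T.lines⊆points t′ t′∈TL) y∈t′ʰ))
      ... | s , s∈TL , t′ʰ≡sᵍ =
        trans t′ʰ≡sᵍ (cong (_^ g) (t-unique s s∈TL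
          (∈-^⁻ s g (subst (x ∈_) t′ʰ≡sᵍ x∈t′ʰ))
          (∈-^⁻ s g (subst (y ∈_) t′ʰ≡sᵍ y∈t′ʰ))))

proposition5p2 : (n : ℕ) (LS : LineSet n) → IsLinearSpace ⊤ LS →
    (G : Permutation n n → Set) → IsPermGroup G →
    (∀ g → G g → IsAut LS g) → LineTransitive G LS →
    (ℓ : Subset n) → LS ℓ →
    (TL : LineSet n) → IsLinearSpace ℓ TL → StabInducesAut G ℓ TL →
    IsLinearSpace ⊤ (OrbitLines G TL) × IsRefinement (OrbitLines G TL) LS ×
      (∀ g → G g → IsAut (OrbitLines G TL) g)
proposition5p2 n LS S-lin G G-grp G-aut G-tr ℓ ℓ∈LS TL T-lin stab =
  orbitLines-isLinearSpace S-lin G-grp G-aut G-tr ℓ∈LS T-lin stab ,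
  orbitLines-refines G-aut ℓ∈LS (IsLinearSpace.lines⊆points T-lin) ,
  orbitLines-isAut G-grp
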